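{- Let $\mathbf{z}_1,\ldots,\mathbf{z}_k\in\mathbb{Z}^d$, let $\mathbf{z}=\mathbf{z}_1+\cdots+\mathbf{z}_k$ and $m=\max_{j}\|\mathbf{z}_j\|_\infty$. There exists a permutation $\sigma$ of $\{1,\ldots,k\}$ such that for every $n\in\{0,\ldots,k\}$ and every $i\in\{1,\ldots,d\}$, $$\sum_{j=1}^n\mathbf{z}_{\sigma(j)}(i)\ \ge\ \min\{\mathbf{z}(i),0\}-md.$$
   Context: $\|\mathbf{x}\|_\infty=\max_i|\mathbf{x}(i)|$. -}

module Defs where

open import Data.Nat using (ℕ; zero; suc; _⊔_)
open import Data.Integer using (ℤ; _+_; ∣_∣) renaming (_⊓_ to _⊓ℤ_)
open import Data.Fin using (Fin; zero; suc; toℕ)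

sumℤ : ℕ → (ℕ → ℤ) → ℤ
sumℤ zero    f = Data.Integer.0ℤ
sumℤ (suc n) f = sumℤ n f + f n

sumFin : ∀ {k} → (Fin k → ℤ) → ℤ
sumFin {zero}  f = Data.Integer.0ℤ
sumFin {suc k} f = f zero + sumFin (λ j → f (suc j))

maxFin : ∀ {k} → (Fin k → ℕ) → ℕ
maxFin {zero}  f = 0
maxFin {suc k} f = f zero ⊔ maxFin (λ j → f (suc j))

‖_‖∞ : ∀ {d} → (Fin d → ℤ) → ℕ
‖ x ‖∞ = maxFin (λ i → ∣ x i ∣)

-- prefix sum over the first n indices (1-based j = 1..n corresponds to Fin indices 0..n-1)
-- of a function g : Fin k → ℤ, i.e. g 0 + … + g (n-1), for n ∈ {0,…,k}
prefixSum : ∀ {k} → (n : Fin (suc k)) → (Fin k → ℤ) → ℤ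
prefixSum zero          g = Data.Integer.0ℤ
prefixSum {zero} (suc ()) g
prefixSum {suc k} (suc n) g = g zero + prefixSum n (λ j → g (suc j))

{-# OPTIONS --safe #-}
module Submission where

-- A fractional selection of z₁, …, z_k is a vector λ ∈ [0,1]^k with Σⱼ λⱼ zⱼ ≥ c := min(z, 0)
-- coordinatewise and Σⱼ (1 − λⱼ) ≤ d; λ ≡ 1 is one. Any fractional selection bounds the full
-- sum, since Σⱼ zⱼ = Σⱼ λⱼ zⱼ + Σⱼ (1 − λⱼ) zⱼ ≥ c − m d. If k > d, scale λ down so that
-- Σⱼ (1 − λⱼ) = d + 1 exactly; as c ≤ 0, this keeps Σⱼ λⱼ zⱼ ≥ c. As long as no λⱼ vanishes,
-- more than d + 1 of them lie strictly between 0 and 1, so the d + 1 linear constraints (total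
-- weight and the d coordinates of Σⱼ λⱼ zⱼ) have a kernel direction supported on them; moving
-- along it until some weight reaches 0 or 1 removes a fractional coordinate. Eventually some
-- λⱼ = 0, and dropping zⱼ leaves a fractional selection of the other k − 1 vectors. So zⱼ can be
-- placed last and the argument repeated on the rest; once at most d vectors remain, λ ≡ 0 is a
-- fractional selection. Weights are kept rational as integers μⱼ over a common denominator Q > 0.

open import Defs

module Sums where

  open import Data.Nat using (zero; suc)
  open import Data.Integer hiding (suc; pred; ∣_∣)
  open import Data.Integer.Properties
  open import Data.Integer.Tactic.RingSolver using (solve-∀)
  open import Data.Fin using (Fin; zero; suc)
  open import Data.Fin.Subset using (Subset; inside; outside; _∈_; _∉_; ∣_∣)
  open import Data.Fin.Subset.Properties using (drop-there)
  open import Data.Vec using ([]; _∷_; here; there)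
  open import Data.Vec.Functional using (removeAt)
  open import Relation.Binary.PropositionalEquality
  open import Function using (_∘_)

  open import Algebra.Properties.Semiring.Sum +-*-semiring public
    using (sum; sum-syntax; sum-cong-≗; sum-remove; sum-permute; ∑-distrib-+; *-distribˡ-sum)

  sumFin≡sum : ∀ {n} (f : Fin n → ℤ) → sumFin f ≡ sum f
  sumFin≡sum {zero}  f = refl
  sumFin≡sum {suc n} f = cong (_+_ (f zero)) (sumFin≡sum (f ∘ suc))

  ∑-mono-≤ : ∀ {n} {f g : Fin n → ℤ} → (∀ j → f j ≤ g j) → sum f ≤ sum g
  ∑-mono-≤ {zero}  f≤g = ≤-refl
  ∑-mono-≤ {suc n} f≤g = +-mono-≤ (f≤g zero) (∑-mono-≤ (f≤g ∘ suc))

  ∑-const : ∀ n (x : ℤ) → ∑[ j < n ] x ≡ + n * x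
  ∑-const zero    x = sym (*-zeroˡ x)
  ∑-const (suc n) x = trans (cong (_+_ x) (∑-const n x)) (sym (suc-* (+ n) x))

  ∑-zero : ∀ {n} {f : Fin n → ℤ} → (∀ j → f j ≡ 0ℤ) → sum f ≡ 0ℤ
  ∑-zero {zero}  f≡0 = refl
  ∑-zero {suc n} f≡0 = cong₂ _+_ (f≡0 zero) (∑-zero (f≡0 ∘ suc))

  ∑-removeAt-0 : ∀ {n} (t : Fin (suc n) → ℤ) {j} → t j ≡ 0ℤ → sum t ≡ sum (removeAt t j)
  ∑-removeAt-0 t {j} tj≡0 =
    trans (sum-remove {i = j} t) (trans (cong (_+ sum (removeAt t j)) tj≡0) (+-identityˡ _))

  ∑-distrib-- : ∀ {n} (f g : Fin n → ℤ) → ∑[ j < n ] (f j - g j) ≡ sum f - sum g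
  ∑-distrib-- {zero}  f g = refl
  ∑-distrib-- {suc n} f g = begin
    (f zero - g zero) + ∑[ j < n ] (f (suc j) - g (suc j))
      ≡⟨ cong (_+_ (f zero - g zero)) (∑-distrib-- (f ∘ suc) (g ∘ suc)) ⟩
    (f zero - g zero) + (sum (f ∘ suc) - sum (g ∘ suc))
      ≡⟨ interchange (f zero) (g zero) (sum (f ∘ suc)) (sum (g ∘ suc)) ⟩
    (f zero + sum (f ∘ suc)) - (g zero + sum (g ∘ suc)) ∎
    where
    open ≡-Reasoning
    interchange : ∀ a b c d → (a - b) + (c - d) ≡ (a + c) - (b + d)
    interchange = solve-∀

  ∑-≤-∣p∣* : ∀ {n} (p : Subset n) {f : Fin n → ℤ} {a : ℤ} →
    (∀ {j} → j ∉ p → f j ≤ 0ℤ) → (∀ {j} → j ∈ p → f j ≤ a) → sum f ≤ + ∣ p ∣ * a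
  ∑-≤-∣p∣* []            {a = a} _ _ = ≤-reflexive (sym (*-zeroˡ a))
  ∑-≤-∣p∣* (outside ∷ p) {f} {a} outside≤0 inside≤a = begin
    f zero + sum (f ∘ suc)
      ≤⟨ +-mono-≤ (outside≤0 λ ()) (∑-≤-∣p∣* p (outside≤0 ∘ (_∘ drop-there)) (inside≤a ∘ there)) ⟩
    0ℤ + + ∣ p ∣ * a
      ≡⟨ +-identityˡ _ ⟩
    + ∣ p ∣ * a ∎
    where open ≤-Reasoning
  ∑-≤-∣p∣* (inside ∷ p)  {f} {a} outside≤0 inside≤a = begin
    f zero + sum (f ∘ suc)
      ≤⟨ +-mono-≤ (inside≤a here) (∑-≤-∣p∣* p (outside≤0 ∘ (_∘ drop-there)) (inside≤a ∘ there)) ⟩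
    a + + ∣ p ∣ * a
      ≡⟨ suc-* (+ ∣ p ∣) a ⟨
    + suc ∣ p ∣ * a ∎
    where open ≤-Reasoning

module Kernel where

  open Sums
  open import Data.Nat as ℕ using (zero; suc)
  import Data.Nat.Properties as ℕP
  open import Data.Integer hiding (suc; pred; ∣_∣)
  open import Data.Integer.Properties
  open import Data.Integer.Tactic.RingSolver using (solve-∀)
  open import Data.Fin using (Fin; zero; suc; punchIn)
  open import Data.Fin.Properties using (any?; punchInᵢ≢i) renaming (_≟_ to _≟ᶠ_)
  open import Data.Fin.Subset using (Subset; inside; outside; _∈_; _∉_; _─_; ⁅_⁆; ∣_∣)
  open import Data.Fin.Subset.Properties using (_∈?_; nonempty?; Empty-unique; ∣⊥∣≡0; p─q⊆p; p─⊥≡p)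
  open import Data.Vec using (_∷_; there)
  open import Data.Bool using (if_then_else_)
  open import Data.Product using (∃-syntax; _,_)
  open import Data.Sum using ([_,_]′)
  open import Relation.Nullary using (yes; no; does; ¬?; _×-dec_; contradiction)
  open import Relation.Nullary.Decidable using (decidable-stable)
  open import Relation.Binary.PropositionalEquality
  open import Function using (_∘_)

  infix 7 _·_
  _·_ : ∀ {n} → (Fin n → ℤ) → (Fin n → ℤ) → ℤ
  f · y = sum (λ j → f j * y j)

  ∑-linear : ∀ {n} a b (f g : Fin n → ℤ) → ∑[ j < n ] (a * f j + b * g j) ≡ a * sum f + b * sum g
  ∑-linear a b f g = begin
    sum (λ j → a * f j + b * g j)             ≡⟨ ∑-distrib-+ (λ j → a * f j) (λ j → b * g j) ⟩
    sum (λ j → a * f j) + sum (λ j → b * g j) ≡⟨ cong₂ _+_ (*-distribˡ-sum a f) (*-distribˡ-sum b g) ⟨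
    a * sum f + b * sum g                     ∎
    where open ≡-Reasoning

  ·-linearʳ : ∀ {n} a b (f u v : Fin n → ℤ) → f · (λ j → a * u j + b * v j) ≡ a * (f · u) + b * (f · v)
  ·-linearʳ a b f u v =
    trans (sum-cong-≗ λ j → distrib a b (f j) (u j) (v j)) (∑-linear a b (λ j → f j * u j) (λ j → f j * v j))
    where
    distrib : ∀ a b x y w → x * (a * y + b * w) ≡ a * (x * y) + b * (x * w)
    distrib = solve-∀

  ·-linearˡ : ∀ {n} a b (u v y : Fin n → ℤ) → (λ j → a * u j + b * v j) · y ≡ a * (u · y) + b * (v · y)
  ·-linearˡ a b u v y =
    trans (sum-cong-≗ λ j → distrib a b (u j) (v j) (y j)) (∑-linear a b (λ j → u j * y j) (λ j → v j * y j))
    where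
    distrib : ∀ a b x w y → (a * x + b * w) * y ≡ a * (x * y) + b * (w * y)
    distrib = solve-∀

  unit : ∀ {n} → Fin n → Fin n → ℤ
  unit p j = if does (j ≟ᶠ p) then 1ℤ else 0ℤ

  unit-diag : ∀ {n} (p : Fin n) → unit p p ≡ 1ℤ
  unit-diag p with p ≟ᶠ p
  ... | yes _  = refl
  ... | no p≢p = contradiction refl p≢p

  unit-off : ∀ {n} {p j : Fin n} → j ≢ p → unit p j ≡ 0ℤ
  unit-off {p = p} {j} j≢p with j ≟ᶠ p
  ... | yes j≡p = contradiction j≡p j≢p
  ... | no _    = refl

  ·-unit : ∀ {n} (f : Fin n → ℤ) (p : Fin n) → f · unit p ≡ f p
  ·-unit {suc n} f p = begin
    f · unit p                                     ≡⟨ sum-remove {i = p} (λ j → f j * unit p j) ⟩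
    f p * unit p p + ∑[ j < n ] term (punchIn p j) ≡⟨ cong₂ _+_ (cong (f p *_) (unit-diag p)) (∑-zero off-p) ⟩
    f p * 1ℤ + 0ℤ                                  ≡⟨ trans (+-identityʳ _) (*-identityʳ (f p)) ⟩
    f p                                            ∎
    where
    open ≡-Reasoning
    term : Fin (suc n) → ℤ
    term j = f j * unit p j
    off-p : ∀ j → term (punchIn p j) ≡ 0ℤ
    off-p j = trans (cong (f (punchIn p j) *_) (unit-off (punchInᵢ≢i p j))) (*-zeroʳ (f (punchIn p j)))

  x∉p─⁅x⁆ : ∀ {n} {p : Subset n} (x : Fin n) → x ∉ p ─ ⁅ x ⁆
  x∉p─⁅x⁆ {p = s ∷ p} zero    ()
  x∉p─⁅x⁆ {p = s ∷ p} (suc x) (there x∈p─⁅x⁆) = x∉p─⁅x⁆ x x∈p─⁅x⁆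

  ∣p∣≤1+∣p─⁅x⁆∣ : ∀ {n} (p : Subset n) x → ∣ p ∣ ℕ.≤ suc ∣ p ─ ⁅ x ⁆ ∣
  ∣p∣≤1+∣p─⁅x⁆∣ (outside ∷ p) zero    = ℕP.m≤n⇒m≤1+n (ℕP.≤-reflexive (cong ∣_∣ (sym (p─⊥≡p p))))
  ∣p∣≤1+∣p─⁅x⁆∣ (inside  ∷ p) zero    = ℕP.≤-reflexive (cong (suc ∘ ∣_∣) (sym (p─⊥≡p p)))
  ∣p∣≤1+∣p─⁅x⁆∣ (outside ∷ p) (suc x) = ∣p∣≤1+∣p─⁅x⁆∣ p x
  ∣p∣≤1+∣p─⁅x⁆∣ (inside  ∷ p) (suc x) = ℕ.s≤s (∣p∣≤1+∣p─⁅x⁆∣ p x)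

  record NontrivialSolution {r n} (E : Fin r → Fin n → ℤ) (p : Subset n) : Set where
    field
      y         : Fin n → ℤ
      supported : ∀ {j} → j ∉ p → y j ≡ 0ℤ
      nonzero   : ∃[ j ] y j ≢ 0ℤ
      solves    : ∀ t → E t · y ≡ 0ℤ

  unit-solution : ∀ {n} {E : Fin zero → Fin n → ℤ} {p : Subset n} {q} → q ∈ p → NontrivialSolution E p
  unit-solution {q = q} q∈p = record
    { y         = unit q
    ; supported = λ {j} j∉p → unit-off {p = q} {j} λ { refl → j∉p q∈p }
    ; nonzero   = q , λ uq≡0 → 1ℤ≢0ℤ (trans (sym (unit-diag q)) uq≡0)
    ; solves    = λ ()
    }
    where
    1ℤ≢0ℤ : 1ℤ ≢ 0ℤ
    1ℤ≢0ℤ ()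

  unpivoted : ∀ {r n} {E : Fin (suc r) → Fin n → ℤ} {p : Subset n} →
    (∀ {q} → q ∈ p → E zero q ≡ 0ℤ) → NontrivialSolution (E ∘ suc) p → NontrivialSolution E p
  unpivoted {E = E} {p} E₀≡0 sol = record
    { y = y ; supported = supported ; nonzero = nonzero
    ; solves = λ { zero → ∑-zero term≡0 ; (suc t) → solves t }
    }
    where
    open NontrivialSolution sol
    term≡0 : ∀ j → E zero j * y j ≡ 0ℤ
    term≡0 j with j ∈? p
    ... | yes j∈p = trans (cong (_* y j) (E₀≡0 j∈p)) (*-zeroˡ (y j))
    ... | no  j∉p = trans (cong (E zero j *_) (supported j∉p)) (*-zeroʳ (E zero j))

  pivot-eliminated : ∀ {r n} → (Fin (suc r) → Fin n → ℤ) → Fin n → Fin r → Fin n → ℤ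
  pivot-eliminated E q t j = E zero q * E (suc t) j + (- E (suc t) q) * E zero j

  -- y = E₀(q) · y′ − (E₀ · y′) · e_q is killed by the pivot row by construction, and by the
  -- other rows because y′ is killed by their combinations that vanish in column q.
  eliminate : ∀ {r n} {E : Fin (suc r) → Fin n → ℤ} {p : Subset n} {q} → q ∈ p → E zero q ≢ 0ℤ →
    NontrivialSolution (pivot-eliminated E q) (p ─ ⁅ q ⁆) → NontrivialSolution E p
  eliminate {E = E} {p} {q} q∈p E₀q≢0 sol = record
    { y = y ; supported = supported ; nonzero = nonzero ; solves = solves }
    where
    module S = NontrivialSolution sol
    a D : ℤ
    a = E zero q
    D = E zero · S.y
    y : _ → ℤ
    y j = a * S.y j + (- D) * unit q j

    y-off-q : ∀ {j} → j ≢ q → y j ≡ a * S.y j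
    y-off-q {j} j≢q = trans (cong (λ u → a * S.y j + (- D) * u) (unit-off {p = q} {j} j≢q))
                            (trans (cong (_+_ (a * S.y j)) (*-zeroʳ (- D))) (+-identityʳ _))

    supported : ∀ {j} → j ∉ p → y j ≡ 0ℤ
    supported {j} j∉p = begin
      y j       ≡⟨ y-off-q (λ { refl → j∉p q∈p }) ⟩
      a * S.y j ≡⟨ cong (a *_) (S.supported (j∉p ∘ p─q⊆p p ⁅ q ⁆)) ⟩
      a * 0ℤ    ≡⟨ *-zeroʳ a ⟩
      0ℤ        ∎
      where open ≡-Reasoning

    nonzero : ∃[ j ] y j ≢ 0ℤ
    nonzero with S.nonzero
    ... | j , y′j≢0 =
      j , λ yj≡0 → [ E₀q≢0 , y′j≢0 ]′ (i*j≡0⇒i≡0∨j≡0 a (trans (sym (y-off-q j≢q)) yj≡0))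
      where
      j≢q : j ≢ q
      j≢q refl = y′j≢0 (S.supported (x∉p─⁅x⁆ q))

    solves : ∀ t → E t · y ≡ 0ℤ
    solves zero = begin
      E zero · y                        ≡⟨ ·-linearʳ a (- D) (E zero) S.y (unit q) ⟩
      a * D + (- D) * (E zero · unit q) ≡⟨ cong (λ u → a * D + (- D) * u) (·-unit (E zero) q) ⟩
      a * D + (- D) * a                 ≡⟨ cancel a D ⟩
      0ℤ                                ∎
      where
      open ≡-Reasoning
      cancel : ∀ a D → a * D + (- D) * a ≡ 0ℤ
      cancel = solve-∀
    solves (suc t) = begin
      Eₜ · y                            ≡⟨ ·-linearʳ a (- D) Eₜ S.y (unit q) ⟩
      a * (Eₜ · S.y) + (- D) * (Eₜ · unit q) ≡⟨ cong (λ u → a * (Eₜ · S.y) + (- D) * u) (·-unit Eₜ q) ⟩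
      a * (Eₜ · S.y) + (- D) * Eₜ q     ≡⟨ swap a (Eₜ · S.y) D (Eₜ q) ⟩
      a * (Eₜ · S.y) + (- Eₜ q) * D     ≡⟨ ·-linearˡ a (- Eₜ q) Eₜ (E zero) S.y ⟨
      pivot-eliminated E q t · S.y      ≡⟨ S.solves t ⟩
      0ℤ                                ∎
      where
      open ≡-Reasoning
      Eₜ : _ → ℤ
      Eₜ = E (suc t)
      swap : ∀ a X D c → a * X + (- D) * c ≡ a * X + (- c) * D
      swap = solve-∀

  kernel : ∀ {n} r (E : Fin r → Fin n → ℤ) (p : Subset n) → r ℕ.< ∣ p ∣ → NontrivialSolution E p
  kernel {n} zero E p 0<∣p∣ with nonempty? p
  ... | yes (q , q∈p) = unit-solution q∈p
  ... | no  p-empty   = contradiction (subst (λ p → 0 ℕ.< ∣ p ∣) (Empty-unique p-empty) 0<∣p∣)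
                                      (ℕP.<-irrefl (sym (∣⊥∣≡0 n)))
  kernel (suc r) E p 1+r<∣p∣ with any? (λ q → q ∈? p ×-dec ¬? (E zero q ≟ 0ℤ))
  ... | yes (q , q∈p , E₀q≢0) =
    eliminate q∈p E₀q≢0
      (kernel r _ (p ─ ⁅ q ⁆) (ℕP.≤-pred (ℕP.≤-trans 1+r<∣p∣ (∣p∣≤1+∣p─⁅x⁆∣ p q))))
  ... | no  no-pivot =
    unpivoted (λ {q} q∈p → decidable-stable (E zero q ≟ 0ℤ) (λ E₀q≢0 → no-pivot (q , q∈p , E₀q≢0)))
              (kernel r (E ∘ suc) p (ℕP.<⇒≤ 1+r<∣p∣))

module Arithmetic where

  open import Data.Nat as ℕ using (ℕ; zero; suc)
  import Data.Nat.Properties as ℕP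
  open import Data.Integer hiding (suc; pred)
  open import Data.Integer.Properties
  open import Data.Integer.Tactic.RingSolver using (solve-∀)
  open import Data.Fin using (Fin; zero; suc)
  open import Data.Fin.Properties using (any?)
  open import Data.Product using (∃; ∃-syntax; _×_; _,_)
  open import Data.Sum using (_⊎_; inj₁; inj₂)
  open import Relation.Unary using (Pred; Decidable)
  open import Relation.Nullary using (yes; no; contradiction)
  open import Relation.Binary.PropositionalEquality
  open import Function using (_∘_)
  open import Level using (0ℓ)

  0≤* : ∀ {a b} → 0ℤ ≤ a → 0ℤ ≤ b → 0ℤ ≤ a * b
  0≤* {a} {b} 0≤a 0≤b = subst (_≤ a * b) (*-zeroʳ a) (*-monoˡ-≤-nonNeg a {{nonNegative 0≤a}} 0≤b)

  0<* : ∀ {a b} → 0ℤ < a → 0ℤ < b → 0ℤ < a * b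
  0<* {a} {b} 0<a 0<b = subst (_< a * b) (*-zeroʳ a) (*-monoˡ-<-pos a {{positive 0<a}} 0<b)

  0<+∣y∣ : ∀ {y} → y ≢ 0ℤ → 0ℤ < + ∣ y ∣
  0<+∣y∣ {+0}       y≢0 = contradiction refl y≢0
  0<+∣y∣ {+[1+ n ]} _   = +<+ (ℕ.s≤s ℕ.z≤n)
  0<+∣y∣ { -[1+ n ]} _  = +<+ (ℕ.s≤s ℕ.z≤n)

  -M≤x : ∀ {x M} → ∣ x ∣ ℕ.≤ M → - + M ≤ x
  -M≤x {+ n}      _    = neg-≤-pos
  -M≤x { -[1+ n ]} ∣x∣≤M = neg-mono-≤ (+≤+ ∣x∣≤M)

  pigeonhole-bound : ∀ {Q} {m g : ℕ} → 0ℤ < Q → Q * + suc m ≤ + g * (Q - 1ℤ) → suc m ℕ.< g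
  pigeonhole-bound {Q} {m} {g} 0<Q Q[1+m]≤g[Q-1] with suc m ℕ.<? g
  ... | yes 1+m<g = 1+m<g
  ... | no  1+m≮g = contradiction Q[1+m]<Q[1+m] (<-irrefl refl)
    where
    open ≤-Reasoning
    expand : ∀ Q x → x * (Q - 1ℤ) ≡ Q * x + - x
    expand = solve-∀
    Q[1+m]<Q[1+m] : Q * + suc m < Q * + suc m
    Q[1+m]<Q[1+m] = begin-strict
      Q * + suc m            ≤⟨ Q[1+m]≤g[Q-1] ⟩
      + g * (Q - 1ℤ)         ≤⟨ *-monoʳ-≤-nonNeg (Q - 1ℤ) {{nonNegative (i≤j⇒0≤j-i (i<j⇒suc[i]≤j 0<Q))}}
                                                 (+≤+ (ℕP.≮⇒≥ 1+m≮g)) ⟩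
      + suc m * (Q - 1ℤ)     ≡⟨ expand Q (+ suc m) ⟩
      Q * + suc m + -[1+ m ] <⟨ +-monoʳ-< (Q * + suc m) (-<+ {n = 0}) ⟩
      Q * + suc m + 0ℤ       ≡⟨ +-identityʳ _ ⟩
      Q * + suc m            ∎

  cross-≤-trans : ∀ {a₁ a₂ a₃ b₁ b₂ b₃} → 0ℤ ≤ b₁ → 0ℤ < b₂ → 0ℤ ≤ b₃ →
    a₁ * b₂ ≤ a₂ * b₁ → a₂ * b₃ ≤ a₃ * b₂ → a₁ * b₃ ≤ a₃ * b₁
  cross-≤-trans {a₁} {a₂} {a₃} {b₁} {b₂} {b₃} 0≤b₁ 0<b₂ 0≤b₃ a₁b₂≤a₂b₁ a₂b₃≤a₃b₂ =
    *-cancelˡ-≤-pos (a₁ * b₃) (a₃ * b₁) b₂ {{positive 0<b₂}} (begin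
      b₂ * (a₁ * b₃) ≡⟨ reorder₁ a₁ b₂ b₃ ⟩
      (a₁ * b₂) * b₃ ≤⟨ *-monoʳ-≤-nonNeg b₃ {{nonNegative 0≤b₃}} a₁b₂≤a₂b₁ ⟩
      (a₂ * b₁) * b₃ ≡⟨ reorder₂ a₂ b₁ b₃ ⟩
      b₁ * (a₂ * b₃) ≤⟨ *-monoˡ-≤-nonNeg b₁ {{nonNegative 0≤b₁}} a₂b₃≤a₃b₂ ⟩
      b₁ * (a₃ * b₂) ≡⟨ reorder₃ a₃ b₁ b₂ ⟩
      b₂ * (a₃ * b₁) ∎)
    where
    open ≤-Reasoning
    reorder₁ : ∀ a₁ b₂ b₃ → b₂ * (a₁ * b₃) ≡ (a₁ * b₂) * b₃
    reorder₁ = solve-∀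
    reorder₂ : ∀ a₂ b₁ b₃ → (a₂ * b₁) * b₃ ≡ b₁ * (a₂ * b₃)
    reorder₂ = solve-∀
    reorder₃ : ∀ a₃ b₁ b₂ → b₁ * (a₃ * b₂) ≡ b₂ * (a₃ * b₁)
    reorder₃ = solve-∀

  argmin-ratio : ∀ {n} {P : Pred (Fin n) 0ℓ} → Decidable P → (a b : Fin n → ℤ) →
    (∀ {j} → P j → 0ℤ < b j) → ∃ P → ∃[ s ] P s × (∀ {j} → P j → a s * b j ≤ a j * b s)
  argmin-ratio {suc n} {P} P? a b 0<b (j₀ , Pj₀) with any? (P? ∘ suc)
  ... | no ¬P∘suc =
    zero , P-zero j₀ Pj₀ , λ { {zero} _ → ≤-refl ; {suc j} Psj → contradiction (j , Psj) ¬P∘suc }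
    where
    P-zero : ∀ j → P j → P zero
    P-zero zero    P0  = P0
    P-zero (suc j) Psj = contradiction (j , Psj) ¬P∘suc
  ... | yes P∘suc with argmin-ratio (P? ∘ suc) (a ∘ suc) (b ∘ suc) 0<b P∘suc
  ...   | t , Pst , t-min with P? zero
  ...     | no ¬P0 = suc t , Pst , λ { {zero} P0 → contradiction P0 ¬P0 ; {suc j} Psj → t-min Psj }
  ...     | yes P0 with a zero * b (suc t) ≤? a (suc t) * b zero
  ...       | no  0≰t = suc t , Pst , λ { {zero} _ → <⇒≤ (≰⇒> 0≰t) ; {suc j} Psj → t-min Psj }
  ...       | yes 0≤t = zero , P0 , λ
    { {zero}  _   → ≤-refl
    ; {suc j} Psj → cross-≤-trans {a zero} {a (suc t)} {a (suc j)}
                      (<⇒≤ (0<b P0)) (0<b Pst) (<⇒≤ (0<b Psj)) 0≤t (t-min Psj)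
    }

  -- how far a coordinate m ∈ [0, Q] may travel in the direction of the sign of y
  room : ℤ → ℤ → ℤ → ℤ
  room Q m (+ _)    = Q - m
  room Q m -[1+ _ ] = m

  0≤room : ∀ {Q m} y → 0ℤ ≤ m → m ≤ Q → 0ℤ ≤ room Q m y
  0≤room (+ _)    0≤m m≤Q = i≤j⇒0≤j-i m≤Q
  0≤room -[1+ _ ] 0≤m m≤Q = 0≤m

  moved-within : ∀ {Q m a b} y → 0ℤ ≤ m → m ≤ Q → 0ℤ ≤ a → 0ℤ ≤ b →
    a * + ∣ y ∣ ≤ room Q m y * b → 0ℤ ≤ b * m + a * y × b * m + a * y ≤ b * Q
  moved-within {Q} {m} {a} {b} (+ n) 0≤m m≤Q 0≤a 0≤b an≤room =
    +-mono-≤ (0≤* 0≤b 0≤m) (0≤* 0≤a (+≤+ ℕ.z≤n)) ,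
    (begin
      b * m + a * + n     ≤⟨ +-monoʳ-≤ (b * m) an≤room ⟩
      b * m + (Q - m) * b ≡⟨ fill b m Q ⟩
      b * Q               ∎)
    where
    open ≤-Reasoning
    fill : ∀ b m Q → b * m + (Q - m) * b ≡ b * Q
    fill = solve-∀
  moved-within {Q} {m} {a} {b} -[1+ n ] 0≤m m≤Q 0≤a 0≤b an≤room =
    (begin
      0ℤ                   ≡⟨ cancel b m ⟨
      b * m - m * b        ≤⟨ +-monoʳ-≤ (b * m) (neg-mono-≤ an≤room) ⟩
      b * m - a * + suc n  ≡⟨ cong (_+_ (b * m)) (neg-distribʳ-* a (+ suc n)) ⟩
      b * m + a * -[1+ n ] ∎) ,
    (begin
      b * m + a * -[1+ n ] ≤⟨ +-monoʳ-≤ (b * m) (*-monoˡ-≤-nonNeg a {{nonNegative 0≤a}} (-≤+ {n = 0})) ⟩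
      b * m + a * 0ℤ       ≡⟨ trans (cong (_+_ (b * m)) (*-zeroʳ a)) (+-identityʳ (b * m)) ⟩
      b * m                ≤⟨ *-monoˡ-≤-nonNeg b {{nonNegative 0≤b}} m≤Q ⟩
      b * Q                ∎)
    where
    open ≤-Reasoning
    cancel : ∀ b m → b * m - m * b ≡ 0ℤ
    cancel = solve-∀

  moved-to-boundary : ∀ Q m {y} → y ≢ 0ℤ →
    let m′ = + ∣ y ∣ * m + room Q m y * y in m′ ≡ 0ℤ ⊎ m′ ≡ + ∣ y ∣ * Q
  moved-to-boundary Q m {+0}       y≢0 = contradiction refl y≢0
  moved-to-boundary Q m {+[1+ n ]} _   = inj₂ (fill (+ suc n) m Q)
    where
    fill : ∀ y m Q → y * m + (Q - m) * y ≡ y * Q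
    fill = solve-∀
  moved-to-boundary Q m { -[1+ n ]} _  = inj₁ (empty (+ suc n) m)
    where
    empty : ∀ y m → y * m + m * (- y) ≡ 0ℤ
    empty = solve-∀

module Selections where

  open Sums
  open Kernel
  open Arithmetic
  open import Data.Nat as ℕ using (zero; suc)
  open import Data.Nat.Induction using (<-wellFounded)
  open import Data.Integer hiding (suc; pred; ∣_∣)
  import Data.Integer as ℤ
  open import Data.Integer.Properties
  open import Data.Integer.Tactic.RingSolver using (solve-∀)
  open import Data.Fin using (Fin; zero; suc)
  open import Data.Fin.Properties using (any?)
  open import Data.Fin.Subset using (Subset; _∈_; _∉_; _⊂_; ∣_∣)
  open import Data.Fin.Subset.Properties using (_∈?_; p⊂q⇒∣p∣<∣q∣)
  open import Data.Vec using (tabulate)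
  open import Data.Vec.Properties using (lookup∘tabulate; lookup⇒[]=; []=⇒lookup)
  open import Data.Bool using (true)
  open import Data.Product using (∃-syntax; _×_; _,_; proj₁; proj₂)
  open import Data.Sum using (inj₁; inj₂)
  open import Induction.WellFounded using (Acc; acc)
  open import Relation.Nullary using (Dec; yes; no; does; ¬?; _×-dec_)
  open import Relation.Nullary.Decidable using (dec-true; decidable-stable)
  open import Relation.Binary.PropositionalEquality
  open import Function using (_∘_)

  record Selection {k d} (z : Fin k → Fin d → ℤ) (c : Fin d → ℤ) (Q : ℤ) (μ : Fin k → ℤ) : Set where
    field
      0<Q    : 0ℤ < Q
      0≤μ    : ∀ j → 0ℤ ≤ μ j
      μ≤Q    : ∀ j → μ j ≤ Q
      covers : ∀ i → Q * c i ≤ ∑[ j < k ] (μ j * z j i)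

  -- Q · Σⱼ (1 − λⱼ) for the weights λ = μ / Q
  deficit : ∀ {k} → ℤ → (Fin k → ℤ) → ℤ
  deficit {k} Q μ = ∑[ j < k ] (Q - μ j)

  Admissible : ∀ {k d} → (Fin k → Fin d → ℤ) → (Fin d → ℤ) → ℤ → (Fin k → ℤ) → Set
  Admissible {d = d} z c Q μ = Selection z c Q μ × deficit Q μ ≤ Q * + d

  Tight : ∀ {k d} → (Fin k → Fin d → ℤ) → (Fin d → ℤ) → ℤ → (Fin k → ℤ) → Set
  Tight {d = d} z c Q μ = Selection z c Q μ × deficit Q μ ≡ Q * + suc d

  interior : ∀ {k} → ℤ → (Fin k → ℤ) → Subset k
  interior Q μ = tabulate λ j → does (0ℤ <? μ j ×-dec μ j <? Q)

  ∈-interior⁺ : ∀ {k Q} {μ : Fin k → ℤ} {j} → 0ℤ < μ j → μ j < Q → j ∈ interior Q μ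
  ∈-interior⁺ {Q = Q} {μ} {j} 0<μj μj<Q =
    lookup⇒[]= j _ (trans (lookup∘tabulate _ j) (dec-true (0ℤ <? μ j ×-dec μ j <? Q) (0<μj , μj<Q)))

  ∈-interior⁻ : ∀ {k Q} {μ : Fin k → ℤ} {j} → j ∈ interior Q μ → 0ℤ < μ j × μ j < Q
  ∈-interior⁻ {Q = Q} {μ} {j} j∈ =
    witness (0ℤ <? μ j ×-dec μ j <? Q) (trans (sym (lookup∘tabulate _ j)) ([]=⇒lookup j∈))
    where
    witness : ∀ {A : Set} (A? : Dec A) → does A? ≡ true → A
    witness (yes a) _ = a

  interior-large : ∀ {k d} {z : Fin k → Fin d → ℤ} {c Q μ} → Tight z c Q μ → (∀ j → μ j ≢ 0ℤ) →
    suc d ℕ.< ∣ interior Q μ ∣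
  interior-large {d = d} {Q = Q} {μ} (S , deficit≡) μ≢0 = pigeonhole-bound 0<Q (begin
    Q * + suc d                   ≡⟨ deficit≡ ⟨
    deficit Q μ                   ≤⟨ ∑-≤-∣p∣* (interior Q μ) outside≤0 inside≤Q-1 ⟩
    + ∣ interior Q μ ∣ * (Q - 1ℤ) ∎)
    where
    open ≤-Reasoning
    open Selection S
    0<μ : ∀ j → 0ℤ < μ j
    0<μ j = ≤∧≢⇒< (0≤μ j) (μ≢0 j ∘ sym)
    outside≤0 : ∀ {j} → j ∉ interior Q μ → Q - μ j ≤ 0ℤ
    outside≤0 {j} j∉ = i≤j⇒i-j≤0 (≮⇒≥ λ μj<Q → j∉ (∈-interior⁺ {Q = Q} {μ} (0<μ j) μj<Q))
    inside≤Q-1 : ∀ {j} → j ∈ interior Q μ → Q - μ j ≤ Q - 1ℤ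
    inside≤Q-1 {j} _ = +-monoʳ-≤ Q (neg-mono-≤ (i<j⇒suc[i]≤j (0<μ j)))

  constraints : ∀ {k d} → (Fin k → Fin d → ℤ) → Fin (suc d) → Fin k → ℤ
  constraints z zero    _ = 1ℤ
  constraints z (suc i) j = z j i

  -- Move μ/Q along y by the largest step a/b (from the ratio test) that keeps every weight in
  -- [0, 1], scaling everything by b to stay integral; the weight at the minimiser s reaches 0 or 1.
  module Move {k d} {z : Fin k → Fin d → ℤ} {c Q μ} (T : Tight z c Q μ)
              (sol : NontrivialSolution (constraints z) (interior Q μ)) where

    open Selection (proj₁ T)
    open NontrivialSolution sol

    ratio-test : ∃[ s ] y s ≢ 0ℤ ×
      (∀ {j} → y j ≢ 0ℤ → room Q (μ s) (y s) * + ℤ.∣ y j ∣ ≤ room Q (μ j) (y j) * + ℤ.∣ y s ∣)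
    ratio-test =
      argmin-ratio (λ j → ¬? (y j ≟ 0ℤ)) (λ j → room Q (μ j) (y j)) (λ j → + ℤ.∣ y j ∣) 0<+∣y∣ nonzero

    s : Fin k
    s = proj₁ ratio-test

    ys≢0 : y s ≢ 0ℤ
    ys≢0 = proj₁ (proj₂ ratio-test)

    a b Q′ : ℤ
    a = room Q (μ s) (y s)
    b = + ℤ.∣ y s ∣
    Q′ = b * Q

    μ′ : Fin k → ℤ
    μ′ j = b * μ j + a * y j

    0<b : 0ℤ < b
    0<b = 0<+∣y∣ ys≢0

    ratio-bound : ∀ j → a * + ℤ.∣ y j ∣ ≤ room Q (μ j) (y j) * b
    ratio-bound j with y j ≟ 0ℤ
    ... | no  yj≢0 = proj₂ (proj₂ ratio-test) yj≢0
    ... | yes yj≡0 rewrite yj≡0 =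
      subst (_≤ room Q (μ j) 0ℤ * b) (sym (*-zeroʳ a)) (0≤* (0≤room 0ℤ (0≤μ j) (μ≤Q j)) (<⇒≤ 0<b))

    ∑y≡0 : sum y ≡ 0ℤ
    ∑y≡0 = trans (sum-cong-≗ λ j → sym (*-identityˡ (y j))) (solves zero)

    covers′ : ∀ i → Q′ * c i ≤ ∑[ j < k ] (μ′ j * z j i)
    covers′ i = begin
      b * Q * c i
        ≡⟨ *-assoc b Q (c i) ⟩
      b * (Q * c i)
        ≤⟨ *-monoˡ-≤-nonNeg b {{nonNegative (<⇒≤ 0<b)}} (covers i) ⟩
      b * ∑μz
        ≡⟨ +-identityʳ _ ⟨
      b * ∑μz + 0ℤ
        ≡⟨ cong (_+_ (b * ∑μz)) (trans (sym (*-zeroʳ a)) (cong (a *_) (sym (solves (suc i))))) ⟩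
      b * ∑μz + a * (constraints z (suc i) · y)
        ≡⟨ ∑-linear b a (λ j → μ j * z j i) (λ j → z j i * y j) ⟨
      ∑[ j < k ] (b * (μ j * z j i) + a * (z j i * y j))
        ≡⟨ sum-cong-≗ (λ j → regroup b a (μ j) (y j) (z j i)) ⟩
      ∑[ j < k ] (μ′ j * z j i) ∎
      where
      open ≤-Reasoning
      ∑μz : ℤ
      ∑μz = ∑[ j < k ] (μ j * z j i)
      regroup : ∀ b a m y x → b * (m * x) + a * (x * y) ≡ (b * m + a * y) * x
      regroup = solve-∀

    selection′ : Selection z c Q′ μ′
    selection′ = record
      { 0<Q    = 0<* 0<b 0<Q
      ; 0≤μ    = λ j → proj₁ (bounds j)
      ; μ≤Q    = λ j → proj₂ (bounds j)
      ; covers = covers′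
      }
      where
      bounds : ∀ j → 0ℤ ≤ μ′ j × μ′ j ≤ Q′
      bounds j = moved-within (y j) (0≤μ j) (μ≤Q j) (0≤room (y s) (0≤μ s) (μ≤Q s)) (<⇒≤ 0<b) (ratio-bound j)

    deficit′ : deficit Q′ μ′ ≡ Q′ * + suc d
    deficit′ = begin
      ∑[ j < k ] (b * Q - μ′ j)                ≡⟨ sum-cong-≗ (λ j → regroup b a Q (μ j) (y j)) ⟩
      ∑[ j < k ] (b * (Q - μ j) + (- a) * y j) ≡⟨ ∑-linear b (- a) (λ j → Q - μ j) y ⟩
      b * deficit Q μ + (- a) * sum y          ≡⟨ cong₂ (λ u v → b * u + (- a) * v) (proj₂ T) ∑y≡0 ⟩
      b * (Q * + suc d) + (- a) * 0ℤ           ≡⟨ collapse b Q (+ suc d) a ⟩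
      b * Q * + suc d                          ∎
      where
      open ≡-Reasoning
      regroup : ∀ b a Q m y → b * Q - (b * m + a * y) ≡ b * (Q - m) + (- a) * y
      regroup = solve-∀
      collapse : ∀ b Q D a → b * (Q * D) + (- a) * 0ℤ ≡ b * Q * D
      collapse = solve-∀

    moving-inside : ∀ {j} → y j ≢ 0ℤ → j ∈ interior Q μ
    moving-inside {j} yj≢0 = decidable-stable (j ∈? interior Q μ) (yj≢0 ∘ supported)

    stays-inside : ∀ {j} → j ∈ interior Q′ μ′ → j ∈ interior Q μ
    stays-inside {j} j∈′ with y j ≟ 0ℤ | ∈-interior⁻ {Q = Q′} {μ′} j∈′
    ... | no  yj≢0 | _              = moving-inside yj≢0
    ... | yes yj≡0 | 0<μ′j , μ′j<Q′ = ∈-interior⁺ {Q = Q} {μ}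
        (*-cancelˡ-<-nonNeg b {{nonNegative (<⇒≤ 0<b)}} (subst₂ _<_ (sym (*-zeroʳ b)) μ′j≡bμj 0<μ′j))
        (*-cancelˡ-<-nonNeg b {{nonNegative (<⇒≤ 0<b)}} (subst (_< Q′) μ′j≡bμj μ′j<Q′))
      where
      μ′j≡bμj : μ′ j ≡ b * μ j
      μ′j≡bμj = trans (cong (λ u → b * μ j + a * u) yj≡0)
                      (trans (cong (_+_ (b * μ j)) (*-zeroʳ a)) (+-identityʳ _))

    s-leaves : s ∉ interior Q′ μ′
    s-leaves s∈′ with ∈-interior⁻ {Q = Q′} {μ′} s∈′ | moved-to-boundary Q (μ s) ys≢0
    ... | 0<μ′s , _      | inj₁ μ′s≡0  = <-irrefl (sym μ′s≡0) 0<μ′s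
    ... | _     , μ′s<Q′ | inj₂ μ′s≡Q′ = <-irrefl μ′s≡Q′ μ′s<Q′

  move : ∀ {k d} {z : Fin k → Fin d → ℤ} {c Q μ} → Tight z c Q μ →
    NontrivialSolution (constraints z) (interior Q μ) →
    ∃[ Q′ ] ∃[ μ′ ] Tight z c Q′ μ′ × interior Q′ μ′ ⊂ interior Q μ
  move T sol = Q′ , μ′ , (selection′ , deficit′) , stays-inside , s , moving-inside ys≢0 , s-leaves
    where open Move T sol

  vertex : ∀ {k d} {z : Fin k → Fin d → ℤ} {c Q μ} → Tight z c Q μ →
    ∃[ Q′ ] ∃[ μ′ ] Tight z c Q′ μ′ × ∃[ j ] μ′ j ≡ 0ℤ
  vertex {k} {d} {z} {c} T = descend T (<-wellFounded _)
    where
    descend : ∀ {Q μ} → Tight z c Q μ → Acc ℕ._<_ ∣ interior Q μ ∣ →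
      ∃[ Q′ ] ∃[ μ′ ] Tight z c Q′ μ′ × ∃[ j ] μ′ j ≡ 0ℤ
    descend {Q} {μ} T (acc smaller) with any? (λ j → μ j ≟ 0ℤ)
    ... | yes zero-weight = Q , μ , T , zero-weight
    ... | no  no-zero     = continue (move T (kernel (suc d) (constraints z) (interior Q μ) large))
      where
      large : suc d ℕ.< ∣ interior Q μ ∣
      large = interior-large T λ j μj≡0 → no-zero (j , μj≡0)
      continue : ∃[ Q′ ] ∃[ μ′ ] Tight z c Q′ μ′ × interior Q′ μ′ ⊂ interior Q μ →
        ∃[ Q′ ] ∃[ μ′ ] Tight z c Q′ μ′ × ∃[ j ] μ′ j ≡ 0ℤ
      continue (Q′ , μ′ , T′ , shrinks) = descend T′ (smaller (p⊂q⇒∣p∣<∣q∣ shrinks))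

module Ordering where

  open Sums
  open Arithmetic using (0≤*; 0<*; -M≤x)
  open Selections
  open import Data.Nat as ℕ using (ℕ; zero; suc)
  import Data.Nat.Properties as ℕP
  open import Data.Integer hiding (suc; pred; ∣_∣)
  import Data.Integer as ℤ
  open import Data.Integer.Properties
  open import Data.Integer.Tactic.RingSolver using (solve-∀)
  open import Data.Fin using (Fin; zero; suc; punchIn; fromℕ; inject₁)
  open import Data.Fin.Permutation using (Permutation′; _⟨$⟩ʳ_; insert; insert-punchIn)
  import Data.Fin.Permutation as Perm
  open import Data.Vec.Functional using (removeAt)
  open import Algebra.Properties.AbelianGroup +-0-abelianGroup using () renaming (∙-cancelˡ to +-cancelˡ-≡)
  open import Data.Product using (∃-syntax; Σ-syntax; _×_; _,_)
  open import Data.Sum using (_⊎_; inj₁; inj₂)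
  open import Relation.Nullary using (yes; no)
  open import Relation.Binary.PropositionalEquality
  open import Function using (_∘_)

  full-selection : ∀ {k d} (z : Fin k → Fin d → ℤ) {c} → (∀ i → c i ≤ ∑[ j < k ] z j i) →
    Admissible z c 1ℤ (λ _ → 1ℤ)
  full-selection {k} {d} z {c} c≤∑z = selection , deficit≤
    where
    selection : Selection z c 1ℤ (λ _ → 1ℤ)
    selection = record
      { 0<Q = +<+ (ℕ.s≤s ℕ.z≤n) ; 0≤μ = λ _ → +≤+ ℕ.z≤n ; μ≤Q = λ _ → ≤-refl
      ; covers = λ i →
          subst₂ _≤_ (sym (*-identityˡ (c i))) (sum-cong-≗ λ j → sym (*-identityˡ (z j i))) (c≤∑z i)
      }
    deficit≤ : ∑[ j < k ] (1ℤ - 1ℤ) ≤ 1ℤ * + d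
    deficit≤ =
      subst₂ _≤_ (sym (∑-zero {k} {λ _ → 1ℤ - 1ℤ} λ _ → refl)) (sym (*-identityˡ (+ d))) (+≤+ ℕ.z≤n)

  empty-selection : ∀ {k d} (z : Fin k → Fin d → ℤ) {c} → (∀ i → c i ≤ 0ℤ) → k ℕ.≤ d →
    Admissible z c 1ℤ (λ _ → 0ℤ)
  empty-selection {k} {d} z {c} c≤0 k≤d = selection , deficit≤
    where
    selection : Selection z c 1ℤ (λ _ → 0ℤ)
    selection = record
      { 0<Q = +<+ (ℕ.s≤s ℕ.z≤n) ; 0≤μ = λ _ → ≤-refl ; μ≤Q = λ _ → +≤+ ℕ.z≤n
      ; covers = λ i → subst₂ _≤_ (sym (*-identityˡ (c i))) (sym (∑-zero λ j → *-zeroˡ (z j i))) (c≤0 i)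
      }
    deficit≤ : ∑[ j < k ] (1ℤ - 0ℤ) ≤ 1ℤ * + d
    deficit≤ =
      subst₂ _≤_ (sym (trans (∑-const k 1ℤ) (*-identityʳ (+ k)))) (sym (*-identityˡ (+ d))) (+≤+ k≤d)

  full-sum-bound : ∀ {k d} {z : Fin k → Fin d → ℤ} {c Q μ} {M} → Admissible z c Q μ →
    (∀ j i → ℤ.∣ z j i ∣ ℕ.≤ M) → ∀ i → c i - + (M ℕ.* d) ≤ ∑[ j < k ] z j i
  full-sum-bound {k} {d} {z} {c} {Q} {μ} {M} (S , deficit≤) ∣z∣≤M i =
    *-cancelˡ-≤-pos (c i - + (M ℕ.* d)) (∑[ j < k ] z j i) Q {{positive 0<Q}} (begin
      Q * (c i - + (M ℕ.* d))
        ≡⟨ cong (λ x → Q * (c i - x)) (pos-* M d) ⟩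
      Q * (c i - + M * + d)
        ≡⟨ regroup Q (c i) (+ M) (+ d) ⟩
      Q * c i + - + M * (Q * + d)
        ≤⟨ +-mono-≤ (covers i) (*-monoˡ-≤-nonPos (- + M) {{ -M-nonPos }} deficit≤) ⟩
      ∑μz + - + M * deficit Q μ
        ≡⟨ cong (_+_ ∑μz) (*-distribˡ-sum (- + M) (λ j → Q - μ j)) ⟩
      ∑μz + ∑[ j < k ] (- + M * (Q - μ j))
        ≤⟨ +-monoʳ-≤ ∑μz (∑-mono-≤ rest-bound) ⟩
      ∑μz + ∑[ j < k ] ((Q - μ j) * z j i)
        ≡⟨ ∑-distrib-+ (λ j → μ j * z j i) (λ j → (Q - μ j) * z j i) ⟨
      ∑[ j < k ] (μ j * z j i + (Q - μ j) * z j i)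
        ≡⟨ sum-cong-≗ (λ j → complement (μ j) Q (z j i)) ⟩
      ∑[ j < k ] (Q * z j i)
        ≡⟨ *-distribˡ-sum Q (λ j → z j i) ⟨
      Q * ∑[ j < k ] z j i ∎)
    where
    open Selection S
    open ≤-Reasoning
    ∑μz : ℤ
    ∑μz = ∑[ j < k ] (μ j * z j i)
    -M-nonPos : NonPositive (- + M)
    -M-nonPos = nonPositive (neg-≤-pos {n = 0})
    rest-bound : ∀ j → - + M * (Q - μ j) ≤ (Q - μ j) * z j i
    rest-bound j = subst (_≤ (Q - μ j) * z j i) (*-comm (Q - μ j) (- + M))
      (*-monoˡ-≤-nonNeg (Q - μ j) {{nonNegative (i≤j⇒0≤j-i (μ≤Q j))}} (-M≤x (∣z∣≤M j i)))
    regroup : ∀ Q c M d → Q * (c - M * d) ≡ Q * c + - M * (Q * d)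
    regroup = solve-∀
    complement : ∀ m Q x → m * x + (Q - m) * x ≡ Q * x
    complement = solve-∀

  rescale : ∀ {k d} r {z : Fin k → Fin d → ℤ} {c Q μ} → k ≡ suc (r ℕ.+ d) → (∀ i → c i ≤ 0ℤ) →
    Admissible z c Q μ → Tight z c (sum μ) (λ j → + r * μ j)
  rescale {k} {d} r {z} {c} {Q} {μ} k≡1+r+d c≤0 (S , deficit≤) = selection , deficit≡
    where
    open Selection S
    open ≤-Reasoning

    Q[1+r]≤∑μ : Q * + suc r ≤ sum μ
    Q[1+r]≤∑μ = i-j≤0⇒i≤j (begin
      Q * + suc r - sum μ                   ≡⟨ regroup Q (+ suc r) (+ d) (sum μ) ⟩
      (+ suc r + + d) * Q - sum μ - Q * + d ≡⟨ cong (λ n → n * Q - sum μ - Q * + d) +[1+r+d]≡+k ⟩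
      + k * Q - sum μ - Q * + d             ≡⟨ cong (_- Q * + d) deficit≡kQ-∑μ ⟨
      deficit Q μ - Q * + d                 ≤⟨ i≤j⇒i-j≤0 deficit≤ ⟩
      0ℤ                                    ∎)
      where
      regroup : ∀ Q r d S → Q * r - S ≡ (r + d) * Q - S - Q * d
      regroup = solve-∀
      +[1+r+d]≡+k : + suc r + + d ≡ + k
      +[1+r+d]≡+k = trans (sym (pos-+ (suc r) d)) (cong +_ (sym k≡1+r+d))
      deficit≡kQ-∑μ : deficit Q μ ≡ + k * Q - sum μ
      deficit≡kQ-∑μ = trans (∑-distrib-- (λ _ → Q) μ) (cong (_- sum μ) (∑-const k Q))

    rQ≤∑μ : + r * Q ≤ sum μ
    rQ≤∑μ = begin
      + r * Q     ≡⟨ *-comm (+ r) Q ⟩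
      Q * + r     ≤⟨ *-monoˡ-≤-nonNeg Q {{nonNegative (<⇒≤ 0<Q)}} (+≤+ (ℕP.n≤1+n r)) ⟩
      Q * + suc r ≤⟨ Q[1+r]≤∑μ ⟩
      sum μ       ∎

    selection : Selection z c (sum μ) (λ j → + r * μ j)
    selection = record
      { 0<Q = <-≤-trans (0<* 0<Q (+<+ (ℕ.s≤s ℕ.z≤n))) Q[1+r]≤∑μ
      ; 0≤μ = λ j → 0≤* {+ r} (+≤+ ℕ.z≤n) (0≤μ j)
      ; μ≤Q = λ j → ≤-trans (*-monoˡ-≤-nonNeg (+ r) (μ≤Q j)) rQ≤∑μ
      ; covers = λ i → begin
          sum μ * c i                    ≤⟨ *-monoʳ-≤-nonPos (c i) {{nonPositive (c≤0 i)}} rQ≤∑μ ⟩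
          + r * Q * c i                  ≡⟨ *-assoc (+ r) Q (c i) ⟩
          + r * (Q * c i)                ≤⟨ *-monoˡ-≤-nonNeg (+ r) (covers i) ⟩
          + r * ∑[ j < k ] (μ j * z j i) ≡⟨ *-distribˡ-sum (+ r) (λ j → μ j * z j i) ⟩
          ∑[ j < k ] (+ r * (μ j * z j i)) ≡⟨ sum-cong-≗ (λ j → sym (*-assoc (+ r) (μ j) (z j i))) ⟩
          ∑[ j < k ] (+ r * μ j * z j i) ∎
      }

    deficit≡ : deficit (sum μ) (λ j → + r * μ j) ≡ sum μ * + suc d
    deficit≡ = begin-equality
      ∑[ j < k ] (sum μ - + r * μ j)
        ≡⟨ ∑-distrib-- (λ _ → sum μ) (λ j → + r * μ j) ⟩
      ∑[ j < k ] sum μ - ∑[ j < k ] (+ r * μ j)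
        ≡⟨ cong₂ _-_ (∑-const k (sum μ)) (sym (*-distribˡ-sum (+ r) μ)) ⟩
      + k * sum μ - + r * sum μ
        ≡⟨ cong (λ n → n * sum μ - + r * sum μ) +k≡+r+[1+d] ⟩
      (+ r + + suc d) * sum μ - + r * sum μ
        ≡⟨ cancel (+ r) (+ suc d) (sum μ) ⟩
      sum μ * + suc d ∎
      where
      +k≡+r+[1+d] : + k ≡ + r + + suc d
      +k≡+r+[1+d] = trans (cong +_ (trans k≡1+r+d (sym (ℕP.+-suc r d)))) (pos-+ r (suc d))
      cancel : ∀ r D S → (r + D) * S - r * S ≡ S * D
      cancel = solve-∀

  drop-zero-weight : ∀ {k d} {z : Fin (suc k) → Fin d → ℤ} {c Q μ} → Tight z c Q μ →
    ∀ {j} → μ j ≡ 0ℤ → Admissible (removeAt z j) c Q (removeAt μ j)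
  drop-zero-weight {k} {d} {z} {c} {Q} {μ} (S , deficit≡) {j} μj≡0 = selection , ≤-reflexive deficit-rest
    where
    open Selection S
    selection : Selection (removeAt z j) c Q (removeAt μ j)
    selection = record
      { 0<Q = 0<Q ; 0≤μ = 0≤μ ∘ punchIn j ; μ≤Q = μ≤Q ∘ punchIn j
      ; covers = λ i → ≤-trans (covers i) (≤-reflexive (∑-removeAt-0 (λ j′ → μ j′ * z j′ i)
                                                          (trans (cong (_* z j i) μj≡0) (*-zeroˡ (z j i)))))
      }
    deficit-rest : deficit Q (removeAt μ j) ≡ Q * + d
    deficit-rest = +-cancelˡ-≡ Q _ _ (begin
      Q + deficit Q (removeAt μ j)       ≡⟨ cong (_+ deficit Q (removeAt μ j)) (+-identityʳ Q) ⟨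
      Q - 0ℤ + deficit Q (removeAt μ j)  ≡⟨ cong (λ u → Q - u + deficit Q (removeAt μ j)) μj≡0 ⟨
      Q - μ j + deficit Q (removeAt μ j) ≡⟨ sum-remove {i = j} (λ j′ → Q - μ j′) ⟨
      deficit Q μ                        ≡⟨ deficit≡ ⟩
      Q * + suc d                        ≡⟨ *-suc Q (+ d) ⟩
      Q + Q * + d                        ∎)
      where open ≡-Reasoning

  drop-one : ∀ {k d} (z : Fin (suc k) → Fin d → ℤ) {c Q μ} → (∀ i → c i ≤ 0ℤ) → Admissible z c Q μ →
    ∃[ j ] ∃[ Q′ ] ∃[ μ′ ] Admissible (removeAt z j) c Q′ μ′
  drop-one {k} {d} z {c} c≤0 A with d ℕ.≤? k
  ... | no  d≰k =
    zero , 1ℤ , (λ _ → 0ℤ) , empty-selection (removeAt z zero) c≤0 (ℕP.<⇒≤ (ℕP.≰⇒> d≰k))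
  ... | yes d≤k = drop (vertex (rescale (k ℕ.∸ d) (cong suc (sym (ℕP.m∸n+n≡m d≤k))) c≤0 A))
    where
    drop : ∃[ Q′ ] ∃[ μ′ ] Tight z c Q′ μ′ × ∃[ j ] μ′ j ≡ 0ℤ →
      ∃[ j ] ∃[ Q′ ] ∃[ μ′ ] Admissible (removeAt z j) c Q′ μ′
    drop (Q′ , μ′ , T′ , j , μ′j≡0) = j , Q′ , removeAt μ′ j , drop-zero-weight T′ μ′j≡0

  prefixSum-cong : ∀ {k} (n : Fin (suc k)) {f g : Fin k → ℤ} → (∀ j → f j ≡ g j) →
    prefixSum n f ≡ prefixSum n g
  prefixSum-cong zero            f≗g = refl
  prefixSum-cong {suc k} (suc n) f≗g = cong₂ _+_ (f≗g zero) (prefixSum-cong n (f≗g ∘ suc))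

  prefixSum-full-or-init : ∀ {k} (n : Fin (suc (suc k))) (f : Fin (suc k) → ℤ) →
    prefixSum n f ≡ sum f ⊎ ∃[ n′ ] prefixSum n f ≡ prefixSum n′ (f ∘ inject₁)
  prefixSum-full-or-init zero               f = inj₂ (zero , refl)
  prefixSum-full-or-init {zero}  (suc zero) f = inj₁ refl
  prefixSum-full-or-init {suc k} (suc n)    f with prefixSum-full-or-init n (f ∘ suc)
  ... | inj₁ full      = inj₁ (cong (_+_ (f zero)) full)
  ... | inj₂ (n′ , eq) = inj₂ (suc n′ , cong (_+_ (f zero)) eq)

  punchIn-fromℕ : ∀ {k} (j : Fin k) → punchIn (fromℕ k) j ≡ inject₁ j
  punchIn-fromℕ zero    = refl
  punchIn-fromℕ (suc j) = cong suc (punchIn-fromℕ j)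

  ordering : ∀ {k d} (z : Fin k → Fin d → ℤ) {c Q μ M} → (∀ i → c i ≤ 0ℤ) →
    (∀ j i → ℤ.∣ z j i ∣ ℕ.≤ M) → Admissible z c Q μ →
    Σ[ σ ∈ Permutation′ k ] ∀ n i → prefixSum n (λ j → z (σ ⟨$⟩ʳ j) i) ≥ c i - + (M ℕ.* d)
  ordering {zero} {d} z {c} {M = M} c≤0 _ _ =
    Perm.id , λ { zero i → ≤-trans (i-j≤i (c i) (+ (M ℕ.* d))) (c≤0 i) }
  ordering {suc k} z c≤0 ∣z∣≤M A with drop-one z c≤0 A
  ... | j , _ , _ , A′ with ordering (removeAt z j) c≤0 (∣z∣≤M ∘ punchIn j) A′
  ...   | σ′ , prefixes′ = σ , prefixes
    where
    σ : Permutation′ (suc k)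
    σ = insert (fromℕ k) j σ′

    σ∘inject₁ : ∀ j′ → σ ⟨$⟩ʳ inject₁ j′ ≡ punchIn j (σ′ ⟨$⟩ʳ j′)
    σ∘inject₁ j′ = trans (cong (σ ⟨$⟩ʳ_) (sym (punchIn-fromℕ j′))) (insert-punchIn (fromℕ k) j σ′ j′)

    prefixes : ∀ n i → prefixSum n (λ j′ → z (σ ⟨$⟩ʳ j′) i) ≥ _
    prefixes n i with prefixSum-full-or-init n (λ j′ → z (σ ⟨$⟩ʳ j′) i)
    ... | inj₁ full        = ≤-trans (full-sum-bound A ∣z∣≤M i)
                               (≤-reflexive (trans (sum-permute (λ j′ → z j′ i) σ) (sym full)))
    ... | inj₂ (n′ , init) = ≤-trans (prefixes′ n′ i) (≤-reflexive (sym (trans init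
                               (prefixSum-cong n′ λ j′ → cong (λ t → z t i) (σ∘inject₁ j′)))))

  ≤-maxFin : ∀ {k} (f : Fin k → ℕ) j → f j ℕ.≤ maxFin f
  ≤-maxFin f zero    = ℕP.m≤m⊔n (f zero) _
  ≤-maxFin f (suc j) = ℕP.≤-trans (≤-maxFin (f ∘ suc) j) (ℕP.m≤n⊔m (f zero) _)

  ∣entry∣≤max‖‖∞ : ∀ {k d} (z : Fin k → Fin d → ℤ) j i → ℤ.∣ z j i ∣ ℕ.≤ maxFin (λ j → ‖ z j ‖∞)
  ∣entry∣≤max‖‖∞ z j i =
    ℕP.≤-trans (≤-maxFin (λ i → ℤ.∣ z j i ∣) i) (≤-maxFin (λ j → ‖ z j ‖∞) j)

open import Data.Nat using (ℕ; suc; _*_)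
open import Data.Integer using (ℤ; _≥_; _-_; _⊓_; +_; 0ℤ)
open import Data.Fin using (Fin)
open import Data.Fin.Permutation using (Permutation′; _⟨$⟩ʳ_)
open import Data.Product using (Σ-syntax)
open import Data.Integer using (_≤_)
open import Data.Integer.Properties using (≤-trans; ≤-reflexive; i⊓j≤i; i⊓j≤j)
open Sums using (sum; sumFin≡sum)
open Ordering using (ordering; full-selection; ∣entry∣≤max‖‖∞)

corollary19 : (k d : ℕ) → (z : Fin k → Fin d → ℤ) →
    Σ[ σ ∈ Permutation′ k ] ((n : Fin (suc k)) → (i : Fin d) →
      prefixSum n (λ j → z ((σ ⟨$⟩ʳ j)) i)
        ≥ (sumFin (λ j → z j i) ⊓ 0ℤ) - + (maxFin (λ j → ‖ z j ‖∞) * d))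
corollary19 k d z = ordering z c≤0 (∣entry∣≤max‖‖∞ z) (full-selection z c≤∑z)
  where
  c≤0 : ∀ i → sumFin (λ j → z j i) ⊓ 0ℤ ≤ 0ℤ
  c≤0 i = i⊓j≤j _ 0ℤ
  c≤∑z : ∀ i → sumFin (λ j → z j i) ⊓ 0ℤ ≤ sum (λ j → z j i)
  c≤∑z i = ≤-trans (i⊓j≤i _ 0ℤ) (≤-reflexive (sumFin≡sum (λ j → z j i)))
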